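{- Let $w\in\widetilde{S}_n$ and let $i<j$ be integers with $w_i>w_j$. If either $j-i<n$ or $w_i-w_j<n$, then there exists an increasing sequence $i=i_1<i_2<\dots<i_k=j$ such that $\ell(w\,t_{i_m,i_{m+1}})=\ell(w)-1$ for each $1\le m<k$.
   Context: $\widetilde{S}_n$ is the set of bijections $w:\mathbb{Z}\to\mathbb{Z}$ with $w(i+n)=w(i)+n$ and $\sum_{i=1}^n w(i)=\binom{n+1}{2}$; write $w_i=w(i)$. For integers $a<b$ with $a\not\equiv b\pmod n$, $t_{a,b}$ is the affine transposition interchanging $a+cn$ and $b+cn$ for all $c\in\mathbb{Z}$ and fixing all other integers; $wt_{a,b}$ denotes composition (first $t_{a,b}$, then $w$). The length $\ell(w)$ is the number of pairs $(a,b)$ with $1\le a\le n$, $a<b$, $w_a>w_b$ (the Coxeter length of $\widetilde{S}_n$ as affine Weyl group of type $\widetilde{A}_{n-1}$). -}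

module Defs where

open import Data.Nat as ℕ using (ℕ; zero; suc; NonZero)
open import Data.Nat.Combinatorics using (_C_)
open import Data.Integer using (ℤ; +_; _+_; _-_; _<_; _≤_; _%ℕ_)
open import Data.Product using (Σ; _×_; _,_)
open import Data.List using (List; length)
open import Data.List.Membership.Propositional using (_∈_)
open import Data.List.Relation.Unary.Unique.Propositional using (Unique)
open import Function.Definitions using (Bijective)
open import Function.Bundles using (_⇔_)
open import Relation.Binary.PropositionalEquality using (_≡_)
open import Relation.Nullary using (¬_; yes; no)

sumFrom1 : (ℤ → ℤ) → ℕ → ℤ
sumFrom1 f zero    = + 0
sumFrom1 f (suc m) = sumFrom1 f m + f (+ suc m)

record AffPerm (n : ℕ) : Set where
  field
    fun      : ℤ → ℤ
    bij      : Bijective _≡_ _≡_ fun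
    periodic : ∀ i → fun (i + + n) ≡ fun i + + n
    sumCond  : sumFrom1 fun n ≡ + ((suc n) C 2)
open AffPerm public

_≡[mod_]_ : ℤ → (n : ℕ) → .{{NonZero n}} → ℤ → Set
a ≡[mod n ] b = a %ℕ n ≡ b %ℕ n

-- the affine transposition t_{a,b} (meaningful when a ≢ b mod n):
-- swaps a + cn and b + cn for all c, fixes everything else
t : (n : ℕ) .{{_ : NonZero n}} → ℤ → ℤ → ℤ → ℤ
t n a b x with x %ℕ n ℕ.≟ a %ℕ n
... | yes _ = (x - a) + b
... | no _ with x %ℕ n ℕ.≟ b %ℕ n
...   | yes _ = (x - b) + a
...   | no _  = x

Inversion : ℕ → (ℤ → ℤ) → ℤ × ℤ → Set
Inversion n f (a , b) = (+ 1 ≤ a) × (a ≤ + n) × (a < b) × (f b < f a)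

HasLength : ℕ → (ℤ → ℤ) → ℕ → Set
HasLength n f m =
  Σ (List (ℤ × ℤ)) λ L → (length L ≡ m) × Unique L × (∀ p → (p ∈ L) ⇔ Inversion n f p)

LengthDrop : ℕ → (ℤ → ℤ) → (ℤ → ℤ) → Set
LengthDrop n f g = Σ ℕ λ m → HasLength n f (suc m) × HasLength n g m

_·t[_,_] : ∀ {n} .{{_ : NonZero n}} → AffPerm n → ℤ → ℤ → ℤ → ℤ
_·t[_,_] {n} w a b x = fun w (t n a b x)

data DescChain {n : ℕ} .{{_ : NonZero n}} (w : AffPerm n) : ℤ → ℤ → Set where
  done : ∀ {i} → DescChain w i i
  step : ∀ {i i' j} → i < i' → ¬ (i ≡[mod n ] i') →
         LengthDrop n (fun w) (w ·t[ i , i' ]) → DescChain w i' j → DescChain w i j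

-- A descent i < j, w_j < w_i, is refined by induction on j - i: if some e strictly between i and j
-- has w_j < w_e < w_i, then (i, e) and (e, j) are shorter descents still satisfying the hypothesis
-- and their chains concatenate; otherwise (i, j) is a covering descent. For a covering descent
-- (c, d) and τ = t_{c,d}, send an inversion (a, b) of wτ to (τ a, τ b) when τ a < τ b and keep it
-- otherwise; up to translation by n this is a bijection onto the inversions of w other than (c, d),
-- so ℓ(wτ) = ℓ(w) - 1. Well-definedness is a case analysis on which of a, b lie in the classes of
-- c and d, and the hypothesis d - c < n or w_c - w_d < n is what rules out the pairs
-- (c + kn, d + jn) with j ≠ k. Both lengths exist because w x - x is bounded for periodic w.

module Submission where

open import Defs
open import Data.Nat as ℕ using (ℕ; NonZero; zero; suc)
import Data.Nat.Properties as ℕₚ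
open import Data.Nat.Properties using (anyUpTo?)
open import Data.Integer
  using ( ℤ; +_; -[1+_]; +[1+_]; -<+; +<+; +≤+; 0ℤ; 1ℤ; -1ℤ
        ; _+_; _-_; _*_; -_; _<_; _≤_; _<?_; _≤?_; _⊓_; _⊔_; _%ℕ_; _/ℕ_; ∣_∣)
open import Data.Integer.Properties
open import Data.Integer.DivMod using (n%ℕd<d; a≡a%ℕn+[a/ℕn]*n)
open import Data.Integer.Tactic.RingSolver using (solve-∀)
open import Data.Product using (Σ; _×_; _,_; proj₁; proj₂; uncurry)
open import Data.Product.Properties using (≡-dec)
open import Data.Sum using (_⊎_; inj₁; inj₂; [_,_]′)
import Data.Sum as Sum
open import Data.Empty using (⊥; ⊥-elim)
open import Data.List using (List; []; _∷_; length; map; filter; cartesianProduct; applyUpTo)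
open import Data.List.Properties using (length-map)
open import Data.List.Membership.Propositional using (_∈_)
open import Data.List.Membership.Propositional.Properties
  using (∈-map⁺; ∈-map⁻; ∈-cartesianProduct⁺; ∈-filter⁺; ∈-filter⁻; ∈-applyUpTo⁺)
open import Data.List.Relation.Unary.Any using (here; there)
import Data.List.Relation.Unary.All as All
open import Data.List.Relation.Unary.All using (All; []; _∷_)
import Data.List.Relation.Unary.All.Properties as All
open import Data.List.Relation.Unary.Unique.Propositional using (Unique)
open import Data.List.Relation.Unary.AllPairs using ([]; _∷_)
import Data.List.Relation.Unary.Unique.Propositional.Properties as Unique
open import Function using (_∘_)
open import Function.Bundles using (_⇔_; mk⇔; Equivalence)
open import Function.Properties.Equivalence using () renaming (trans to ⇔-trans)
open import Relation.Binary.Definitions using (DecidableEquality; tri<; tri≈; tri>)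
open import Relation.Binary.PropositionalEquality
open import Relation.Nullary using (¬_; Dec; yes; no)
open import Relation.Nullary.Decidable using (_×-dec_)

-- Linear arithmetic is done by certificates: u ≤ v is recorded as 0 ≤ v - u and u < v as
-- 0 ≤ v - u - 1; a consequence follows once a sum of recorded quantities is ring-equal to
-- the quantity it needs, and a contradiction once such a sum is ring-equal to -1.

infix 4 0≤_

0≤_ : ℤ → Set
0≤ x = 0ℤ ≤ x

≤-gap : ∀ {u v} → u ≤ v → 0≤ v - u
≤-gap = i≤j⇒0≤j-i

<-gap : ∀ {u v} → u < v → 0≤ v - u - 1ℤ
<-gap {u} {v} u<v = subst 0≤_ (suc-shift u v) (≤-gap (i<j⇒suc[i]≤j u<v))
  where suc-shift : ∀ u v → v - (1ℤ + u) ≡ v - u - 1ℤ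
        suc-shift = solve-∀

0≤-+ : ∀ {x y} → 0≤ x → 0≤ y → 0≤ x + y
0≤-+ = +-mono-≤

0≤-ℕ : ∀ m → 0≤ + m
0≤-ℕ m = +≤+ ℕ.z≤n

gap⇒≤ : ∀ {x u v} → 0≤ x → x ≡ v - u → u ≤ v
gap⇒≤ 0≤x refl = 0≤i-j⇒j≤i 0≤x

gap⇒< : ∀ {x u v} → 0≤ x → x ≡ v - u - 1ℤ → u < v
gap⇒< {u = u} {v} 0≤x refl = suc[i]≤j⇒i<j (gap⇒≤ 0≤x (suc-shift u v))
  where suc-shift : ∀ u v → v - u - 1ℤ ≡ v - (1ℤ + u)
        suc-shift = solve-∀

+-cancelʳ-< : ∀ {u v} m → u + m < v + m → u < v
+-cancelʳ-< {u} {v} m u+m<v+m = gap⇒< (<-gap u+m<v+m) (cancel u v m)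
  where cancel : ∀ u v m → v + m - (u + m) - 1ℤ ≡ v - u - 1ℤ
        cancel = solve-∀

refute : ∀ {x} → 0≤ x → x ≡ -1ℤ → ⊥
refute 0≤x refl = ≤⇒≯ 0≤x (-<+ {0} {0})

Counts : {A : Set} → (A → Set) → ℕ → Set
Counts {A} P m = Σ (List A) λ L → (length L ≡ m) × Unique L × (∀ x → (x ∈ L) ⇔ P x)

Counts-cong : ∀ {A : Set} {P Q : A → Set} {m} → (∀ x → P x ⇔ Q x) → Counts P m → Counts Q m
Counts-cong P⇔Q (L , len , uniq , mem) = L , len , uniq , λ x → ⇔-trans (mem x) (P⇔Q x)

map-Unique-on : ∀ {A : Set} {P : A → Set} (φ : A → A) →
                (∀ {x y} → P x → P y → φ x ≡ φ y → x ≡ y) →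
                ∀ {xs} → All P xs → Unique xs → Unique (map φ xs)
map-Unique-on φ inj []         []          = []
map-Unique-on φ inj (px ∷ pxs) (x∉ ∷ uniq) =
  All.map⁺ (All.zipWith (λ (py , x≢y) φx≡φy → x≢y (inj px py φx≡φy)) (pxs , x∉))
  ∷ map-Unique-on φ inj pxs uniq

module _ {A : Set} {P Q : A → Set} (_≟_ : DecidableEquality A) (φ ψ : A → A) (q₀ : A) (Q-q₀ : Q q₀)
         (φ-into : ∀ {p} → P p → Q (φ p) × φ p ≢ q₀)
         (ψ-φ : ∀ {p} → P p → ψ (φ p) ≡ p)
         (ψ-into : ∀ {q} → Q q → q ≢ q₀ → P (ψ q))
         (φ-ψ : ∀ {q} → Q q → q ≢ q₀ → φ (ψ q) ≡ q)
  where

  Counts-suc : ∀ {m} → Counts P m → Counts Q (suc m)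
  Counts-suc (L , len , uniq , mem) =
    q₀ ∷ map φ L , cong suc (trans (length-map φ L) len) ,
    (q₀∉ ∷ map-Unique-on φ φ-injective P-L uniq) , mem-Q
    where
    P-L : All P L
    P-L = All.tabulate (Equivalence.to (mem _))

    φ-injective : ∀ {x y} → P x → P y → φ x ≡ φ y → x ≡ y
    φ-injective px py φx≡φy = trans (sym (ψ-φ px)) (trans (cong ψ φx≡φy) (ψ-φ py))

    q₀∉ : All (q₀ ≢_) (map φ L)
    q₀∉ = All.map⁺ (All.map (λ px q₀≡φx → proj₂ (φ-into px) (sym q₀≡φx)) P-L)

    mem-Q : ∀ q → (q ∈ q₀ ∷ map φ L) ⇔ Q q
    mem-Q q = mk⇔ to from
      where
      to : q ∈ q₀ ∷ map φ L → Q q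
      to (here refl) = Q-q₀
      to (there q∈) with ∈-map⁻ φ q∈
      ... | p , p∈ , refl = proj₁ (φ-into (Equivalence.to (mem p) p∈))

      from : Q q → q ∈ q₀ ∷ map φ L
      from Qq with q ≟ q₀
      ... | yes refl = here refl
      ... | no q≢q₀ = there (subst (_∈ map φ L) (φ-ψ Qq q≢q₀)
                              (∈-map⁺ φ (Equivalence.from (mem (ψ q)) (ψ-into Qq q≢q₀))))

module _ (n : ℕ) .{{_ : NonZero n}} where

  N : ℤ
  N = + n

  0≤-*N : ∀ m → 0≤ + m * N
  0≤-*N m = subst 0≤_ (pos-* m n) (0≤-ℕ (m ℕ.* n))

  *N<N⇒≡0⊎≤-N : ∀ k → k * N < N → k ≡ 0ℤ ⊎ k * N ≤ - N
  *N<N⇒≡0⊎≤-N (+ zero)  _   = inj₁ refl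
  *N<N⇒≡0⊎≤-N +[1+ m ]  kN<N = ⊥-elim (refute (0≤-+ (<-gap kN<N) (0≤-*N m)) (cancel (+ m) N))
    where cancel : ∀ m N → N - (1ℤ + m) * N - 1ℤ + m * N ≡ -1ℤ
          cancel = solve-∀
  *N<N⇒≡0⊎≤-N -[1+ m ]  _   = inj₂ (gap⇒≤ (0≤-*N m) (cancel (+ m) N))
    where cancel : ∀ m N → m * N ≡ - N - (- (1ℤ + m)) * N
          cancel = solve-∀

  multiple-within-period⇒≡0 : ∀ k → - N < k * N → k * N < N → k ≡ 0ℤ
  multiple-within-period⇒≡0 k -N<kN kN<N with *N<N⇒≡0⊎≤-N k kN<N
  ... | inj₁ k≡0   = k≡0
  ... | inj₂ kN≤-N = ⊥-elim (≤⇒≯ kN≤-N -N<kN)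

  Periodic : (ℤ → ℤ) → Set
  Periodic F = ∀ x → F (x + N) ≡ F x + N

  module _ {F : ℤ → ℤ} (F-periodic : Periodic F) where

    periodic-shift-ℕ : ∀ x m → F (x + + m * N) ≡ F x + + m * N
    periodic-shift-ℕ x zero = begin
      F (x + 0ℤ)  ≡⟨ cong F (+-identityʳ x) ⟩
      F x         ≡⟨ sym (+-identityʳ (F x)) ⟩
      F x + 0ℤ    ∎
      where open ≡-Reasoning
    periodic-shift-ℕ x (suc m) = begin
      F (x + (1ℤ + + m) * N)    ≡⟨ cong F (regroup x (+ m) N) ⟩
      F (x + + m * N + N)       ≡⟨ F-periodic _ ⟩
      F (x + + m * N) + N       ≡⟨ cong (_+ N) (periodic-shift-ℕ x m) ⟩
      F x + + m * N + N         ≡⟨ sym (regroup (F x) (+ m) N) ⟩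
      F x + (1ℤ + + m) * N      ∎
      where
      open ≡-Reasoning
      regroup : ∀ x m N → x + (1ℤ + m) * N ≡ x + m * N + N
      regroup = solve-∀

    periodic-shift : ∀ x k → F (x + k * N) ≡ F x + k * N
    periodic-shift x (+ m)    = periodic-shift-ℕ x m
    periodic-shift x -[1+ m ] = begin
      F (x + - K * N)               ≡⟨ cong F (neg-* x K N) ⟩
      F (x - K * N)                 ≡⟨ add-sub (F (x - K * N)) (K * N) ⟩
      F (x - K * N) + K * N - K * N ≡⟨ cong (_- K * N) (sym (periodic-shift-ℕ (x - K * N) (suc m))) ⟩
      F (x - K * N + K * N) - K * N ≡⟨ cong (λ y → F y - K * N) (sub-add x (K * N)) ⟩
      F x - K * N                   ≡⟨ sym (neg-* (F x) K N) ⟩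
      F x + - K * N                 ∎
      where
      open ≡-Reasoning
      K = + suc m
      neg-* : ∀ x k N → x + (- k) * N ≡ x - k * N
      neg-* = solve-∀
      add-sub : ∀ y z → y ≡ y + z - z
      add-sub = solve-∀
      sub-add : ∀ x z → x - z + z ≡ x
      sub-add = solve-∀

  division : ∀ x → x ≡ + (x %ℕ n) + (x /ℕ n) * N
  division x = a≡a%ℕn+[a/ℕn]*n x n

  ≡[mod]⇒shift : ∀ x y → x ≡[mod n ] y → Σ ℤ λ k → x ≡ y + k * N
  ≡[mod]⇒shift x y x≡y = k , (begin
    x                                   ≡⟨ division x ⟩
    + (x %ℕ n) + (x /ℕ n) * N           ≡⟨ cong (λ r → + r + (x /ℕ n) * N) x≡y ⟩
    + (y %ℕ n) + (x /ℕ n) * N           ≡⟨ regroup (+ (y %ℕ n)) (x /ℕ n) (y /ℕ n) N ⟩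
    + (y %ℕ n) + (y /ℕ n) * N + k * N   ≡⟨ cong (_+ k * N) (sym (division y)) ⟩
    y + k * N                           ∎)
    where
    open ≡-Reasoning
    k = x /ℕ n - y /ℕ n
    regroup : ∀ r a b N → r + a * N ≡ r + b * N + (a - b) * N
    regroup = solve-∀

  residue-unique : ∀ {r r'} k → r ℕ.< n → r' ℕ.< n → + r ≡ + r' + k * N → r ≡ r'
  residue-unique {r} {r'} k r<n r'<n r≡r'+kN = +-injective (begin
    + r             ≡⟨ r≡r'+kN ⟩
    + r' + k * N    ≡⟨ cong (λ j → + r' + j * N) k≡0 ⟩
    + r' + 0ℤ       ≡⟨ +-identityʳ (+ r') ⟩
    + r'            ∎)
    where
    open ≡-Reasoning
    k≡0 : k ≡ 0ℤ
    k≡0 = multiple-within-period⇒≡0 k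
      (gap⇒< (0≤-+ (0≤-ℕ r) (<-gap (+<+ r'<n))) (lower (+ r) (+ r') (k * N) N r≡r'+kN))
      (gap⇒< (0≤-+ (<-gap (+<+ r<n)) (0≤-ℕ r')) (upper (+ r) (+ r') (k * N) N r≡r'+kN))
      where
      lower : ∀ r r' m N → r ≡ r' + m → r + (N - r' - 1ℤ) ≡ m - (- N) - 1ℤ
      lower _ r' m N refl = cancel r' m N
        where cancel : ∀ r' m N → r' + m + (N - r' - 1ℤ) ≡ m - (- N) - 1ℤ
              cancel = solve-∀
      upper : ∀ r r' m N → r ≡ r' + m → (N - r - 1ℤ) + r' ≡ N - m - 1ℤ
      upper _ r' m N refl = cancel r' m N
        where cancel : ∀ r' m N → (N - (r' + m) - 1ℤ) + r' ≡ N - m - 1ℤ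
              cancel = solve-∀

  shift⇒≡[mod] : ∀ y k → (y + k * N) ≡[mod n ] y
  shift⇒≡[mod] y k = residue-unique (y /ℕ n + k - x /ℕ n) (n%ℕd<d x n) (n%ℕd<d y n) (begin
    + (x %ℕ n)                                          ≡⟨ add-sub (+ (x %ℕ n)) (x /ℕ n * N) ⟩
    + (x %ℕ n) + x /ℕ n * N - x /ℕ n * N                ≡⟨ cong (_- x /ℕ n * N) (sym (division x)) ⟩
    y + k * N - x /ℕ n * N                              ≡⟨ cong (λ z → z + k * N - x /ℕ n * N) (division y) ⟩
    + (y %ℕ n) + y /ℕ n * N + k * N - x /ℕ n * N        ≡⟨ regroup (+ (y %ℕ n)) (y /ℕ n) k (x /ℕ n) N ⟩
    + (y %ℕ n) + (y /ℕ n + k - x /ℕ n) * N              ∎)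
    where
    open ≡-Reasoning
    x = y + k * N
    add-sub : ∀ r z → r ≡ r + z - z
    add-sub = solve-∀
    regroup : ∀ r b k a N → r + b * N + k * N - a * N ≡ r + (b + k - a) * N
    regroup = solve-∀

  shift : ℤ → ℤ × ℤ → ℤ × ℤ
  shift k (a , b) = a + k * N , b + k * N

  shift-shift : ∀ j k p → shift k (shift j p) ≡ shift (j + k) p
  shift-shift j k (a , b) = cong₂ _,_ (regroup a j k N) (regroup b j k N)
    where regroup : ∀ a j k N → a + j * N + k * N ≡ a + (j + k) * N
          regroup = solve-∀

  shift-zero : ∀ p → shift 0ℤ p ≡ p
  shift-zero (a , b) = cong₂ _,_ (+-identityʳ a) (+-identityʳ b)

  shift-cancel : ∀ k p → shift (- k) (shift k p) ≡ p
  shift-cancel k p = trans (shift-shift k (- k) p) (trans (cong (λ j → shift j p) (+-inverseʳ k)) (shift-zero p))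

  InWindow : ℤ × ℤ → Set
  InWindow (a , _) = + 1 ≤ a × a ≤ N

  InWindow-shift : ∀ k p → InWindow p → InWindow (shift k p) → shift k p ≡ p
  InWindow-shift k p@(a , _) (1≤a , a≤N) (1≤a' , a'≤N) = trans (cong (λ j → shift j p) k≡0) (shift-zero p)
    where
    k≡0 : k ≡ 0ℤ
    k≡0 = multiple-within-period⇒≡0 k
      (gap⇒< (0≤-+ (≤-gap 1≤a') (≤-gap a≤N)) (lower a k N))
      (gap⇒< (0≤-+ (≤-gap 1≤a) (≤-gap a'≤N)) (upper a k N))
      where
      lower : ∀ a k N → a + k * N - + 1 + (N - a) ≡ k * N - (- N) - 1ℤ
      lower = solve-∀
      upper : ∀ a k N → a - + 1 + (N - (a + k * N)) ≡ N - k * N - 1ℤ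
      upper = solve-∀

  window-offset : ℤ → ℤ
  window-offset a = - ((a - 1ℤ) /ℕ n)

  normalise : ℤ × ℤ → ℤ × ℤ
  normalise (a , b) = shift (window-offset a) (a , b)

  normalise-is-shift : ∀ p → Σ ℤ λ k → normalise p ≡ shift k p
  normalise-is-shift (a , b) = window-offset a , refl

  normalise-InWindow : ∀ p → InWindow (normalise p)
  normalise-InWindow (a , b) =
    gap⇒≤ (0≤-ℕ r) (sym (lower (+ r) q a N a≡)) ,
    gap⇒≤ (<-gap (+<+ (n%ℕd<d (a - 1ℤ) n))) (sym (upper (+ r) q a N a≡))
    where
    r = (a - 1ℤ) %ℕ n
    q = (a - 1ℤ) /ℕ n
    a≡ : a ≡ + r + q * N + 1ℤ
    a≡ = trans (sub-add a) (cong (_+ 1ℤ) (division (a - 1ℤ)))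
      where sub-add : ∀ a → a ≡ a - 1ℤ + 1ℤ
            sub-add = solve-∀
    lower : ∀ r q a N → a ≡ r + q * N + 1ℤ → a + (- q) * N - + 1 ≡ r
    lower r q _ N refl = cancel r q N
      where cancel : ∀ r q N → r + q * N + 1ℤ + (- q) * N - + 1 ≡ r
            cancel = solve-∀
    upper : ∀ r q a N → a ≡ r + q * N + 1ℤ → N - (a + (- q) * N) ≡ N - r - 1ℤ
    upper r q _ N refl = cancel r q N
      where cancel : ∀ r q N → N - (r + q * N + 1ℤ + (- q) * N) ≡ N - r - 1ℤ
            cancel = solve-∀

  normalise-InWindow-id : ∀ p → InWindow p → normalise p ≡ p
  normalise-InWindow-id p@(a , _) p∈W = InWindow-shift (window-offset a) p p∈W (normalise-InWindow p)

  normalise-shift : ∀ k p → normalise (shift k p) ≡ normalise p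
  normalise-shift k p@(a , _) = begin
    normalise (shift k p)       ≡⟨ as-shift-of-q ⟩
    shift (k + i - j) q         ≡⟨ InWindow-shift (k + i - j) q (normalise-InWindow p) q'∈W ⟩
    q                           ∎
    where
    open ≡-Reasoning
    i = window-offset (proj₁ (shift k p))
    j = window-offset a
    q = normalise p
    regroup : ∀ j k i → k + i ≡ j + (k + i - j)
    regroup = solve-∀
    as-shift-of-q : normalise (shift k p) ≡ shift (k + i - j) q
    as-shift-of-q = begin
      normalise (shift k p)       ≡⟨ shift-shift k i p ⟩
      shift (k + i) p             ≡⟨ cong (λ l → shift l p) (regroup j k i) ⟩
      shift (j + (k + i - j)) p   ≡⟨ sym (shift-shift j (k + i - j) p) ⟩
      shift (k + i - j) q         ∎
    q'∈W : InWindow (shift (k + i - j) q)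
    q'∈W = subst InWindow as-shift-of-q (normalise-InWindow (shift k p))

  normalise-≡⇒shift : ∀ p q → normalise p ≡ normalise q → Σ ℤ λ k → p ≡ shift k q
  normalise-≡⇒shift p@(a , _) q@(b , _) eq = j - i , (begin
    p                         ≡⟨ sym (shift-cancel i p) ⟩
    shift (- i) (normalise p) ≡⟨ cong (shift (- i)) eq ⟩
    shift (- i) (shift j q)   ≡⟨ shift-shift j (- i) q ⟩
    shift (j - i) q           ∎)
    where
    open ≡-Reasoning
    i = window-offset a
    j = window-offset b

  Inverted : (ℤ → ℤ) → ℤ × ℤ → Set
  Inverted F (a , b) = a < b × F b < F a

  Inverted-shift : ∀ {F} → Periodic F → ∀ k p → Inverted F p → Inverted F (shift k p)
  Inverted-shift {F} F-periodic k (a , b) (a<b , Fb<Fa) =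
    +-monoˡ-< (k * N) a<b ,
    subst₂ _<_ (sym (periodic-shift {F} F-periodic b k)) (sym (periodic-shift {F} F-periodic a k))
               (+-monoˡ-< (k * N) Fb<Fa)

  Inverted-normalise : ∀ {F} → Periodic F → ∀ p → Inverted F p → Inverted F (normalise p)
  Inverted-normalise {F} F-periodic (a , b) = Inverted-shift {F} F-periodic (window-offset a) (a , b)

  Inversion⇔ : ∀ F p → Inversion n F p ⇔ (InWindow p × Inverted F p)
  Inversion⇔ F (a , b) = mk⇔ split join
    where
    split : Inversion n F (a , b) → InWindow (a , b) × Inverted F (a , b)
    split (1≤a , a≤N , inv) = (1≤a , a≤N) , inv
    join : InWindow (a , b) × Inverted F (a , b) → Inversion n F (a , b)
    join ((1≤a , a≤N) , inv) = 1≤a , a≤N , inv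

  range : ℕ → List ℤ
  range m = applyUpTo (λ i → + suc i) m

  ∈-range : ∀ {m x} → + 1 ≤ x → x ≤ + m → x ∈ range m
  ∈-range {x = +[1+ i ]} _ (+≤+ i<m) = ∈-applyUpTo⁺ (λ i → + suc i) i<m
  ∈-range {x = + zero} (+≤+ ()) _

  range-Unique : ∀ m → Unique (range m)
  range-Unique m = Unique.applyUpTo⁺₁ (λ i → + suc i) m
    (λ i<j _ eq → ℕₚ.<⇒≢ i<j (ℕₚ.suc-injective (+-injective eq)))

  module _ {F : ℤ → ℤ} (F-periodic : Periodic F) where

    displacement-shift : ∀ x k → F (x + k * N) - (x + k * N) ≡ F x - x
    displacement-shift x k = trans (cong (_- (x + k * N)) (periodic-shift {F} F-periodic x k)) (cancel (F x) x k N)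
      where cancel : ∀ y x k N → y + k * N - (x + k * N) ≡ y - x
            cancel = solve-∀

    Bounds : ℤ → ℤ → ℤ → Set
    Bounds lo hi x = lo ≤ F x - x × F x - x ≤ hi

    displacement-bounds-upto : ∀ m → Σ ℤ λ lo → Σ ℤ λ hi → ∀ r → r ℕ.< m → Bounds lo hi (+ suc r)
    displacement-bounds-upto zero = 0ℤ , 0ℤ , λ _ ()
    displacement-bounds-upto (suc m) with displacement-bounds-upto m
    ... | lo , hi , bounds = lo ⊓ D , hi ⊔ D , extended
      where
      D = F (+ suc m) - + suc m
      extended : ∀ r → r ℕ.< suc m → Bounds (lo ⊓ D) (hi ⊔ D) (+ suc r)
      extended r r<1+m with ℕₚ.m<1+n⇒m<n∨m≡n r<1+m
      ... | inj₁ r<m  = ≤-trans (i⊓j≤i lo D) (proj₁ (bounds r r<m)) ,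
                        ≤-trans (proj₂ (bounds r r<m)) (i≤i⊔j hi D)
      ... | inj₂ refl = i⊓j≤j lo D , i≤j⊔i hi D

    displacement-bounded : Σ ℤ λ lo → Σ ℤ λ hi → ∀ x → Bounds lo hi x
    displacement-bounded with displacement-bounds-upto n
    ... | lo , hi , bounds = lo , hi , λ x → subst (Bounds lo hi) (sym (x≡ x)) (bounds-shifted x)
      where
      r : ℤ → ℕ
      q : ℤ → ℤ
      r x = (x - 1ℤ) %ℕ n
      q x = (x - 1ℤ) /ℕ n
      x≡ : ∀ x → x ≡ + suc (r x) + q x * N
      x≡ x = trans (sub-add x) (trans (cong (_+ 1ℤ) (division (x - 1ℤ))) (regroup (+ r x) (q x) N))
        where sub-add : ∀ x → x ≡ x - 1ℤ + 1ℤ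
              sub-add = solve-∀
              regroup : ∀ r q N → r + q * N + 1ℤ ≡ 1ℤ + r + q * N
              regroup = solve-∀
      bounds-shifted : ∀ x → Bounds lo hi (+ suc (r x) + q x * N)
      bounds-shifted x = subst (λ d → lo ≤ d × d ≤ hi) (sym (displacement-shift (+ suc (r x)) (q x)))
                               (bounds (r x) (n%ℕd<d (x - 1ℤ) n))

    periodic-HasLength : Σ ℕ (HasLength n F)
    periodic-HasLength = length inversions , inversions ,
      refl , Unique.filter⁺ Inversion? (Unique.cartesianProduct⁺ (range-Unique n) (range-Unique M)) ,
      λ p → mk⇔ (λ p∈ → proj₂ (∈-filter⁻ Inversion? {xs = box} p∈))
                (λ inv → ∈-filter⁺ Inversion? (∈-box p inv) inv)
      where
      lo = proj₁ displacement-bounded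
      hi = proj₁ (proj₂ displacement-bounded)
      bounded = proj₂ (proj₂ displacement-bounded)
      M = ∣ N + hi - lo ∣
      box = cartesianProduct (range n) (range M)

      Inversion? : ∀ p → Dec (Inversion n F p)
      Inversion? (a , b) = (+ 1 ≤? a) ×-dec ((a ≤? N) ×-dec ((a <? b) ×-dec (F b <? F a)))

      inversions = filter Inversion? box

      ∈-box : ∀ p → Inversion n F p → p ∈ box
      ∈-box (a , b) (1≤a , a≤N , a<b , Fb<Fa) = ∈-cartesianProduct⁺ (∈-range 1≤a a≤N) (∈-range 1≤b b≤M)
        where
        1≤b = ≤-trans 1≤a (<⇒≤ a<b)
        b<N+hi-lo : b < N + hi - lo
        b<N+hi-lo = gap⇒<
          (0≤-+ (0≤-+ (0≤-+ (≤-gap (proj₁ (bounded b))) (≤-gap (proj₂ (bounded a)))) (≤-gap a≤N)) (<-gap Fb<Fa))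
          (cancel lo hi N a b (F a) (F b))
          where
          cancel : ∀ lo hi N a b Fa Fb →
                   Fb - b - lo + (hi - (Fa - a)) + (N - a) + (Fa - Fb - 1ℤ) ≡ N + hi - lo - b - 1ℤ
          cancel = solve-∀
        b≤M : b ≤ + M
        b≤M = ≤-trans (<⇒≤ b<N+hi-lo)
          (≤-reflexive (sym (0≤i⇒+∣i∣≡i (<⇒≤ (≤-<-trans (≤-trans (0≤-ℕ 1) 1≤b) b<N+hi-lo)))))

  +N-≡[mod] : ∀ x → (x + N) ≡[mod n ] x
  +N-≡[mod] x = subst (λ y → (x + y) ≡[mod n ] x) (*-identityˡ N) (shift⇒≡[mod] x 1ℤ)

  translates-keep-order : ∀ {u v k j} → u + k * N < u + j * N → v + j * N ≤ v + k * N → ⊥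
  translates-keep-order {u} {v} {k} {j} ukN<ujN vjN≤vkN =
    refute (0≤-+ (<-gap ukN<ujN) (≤-gap vjN≤vkN)) (cancel u v k j N)
    where cancel : ∀ u v k j N → u + j * N - (u + k * N) - 1ℤ + (v + k * N - (v + j * N)) ≡ -1ℤ
          cancel = solve-∀

  module Transposition (c d : ℤ) (c<d : c < d) (c≢d : ¬ c ≡[mod n ] d) where

    -- Opaque: τ is used only through τ-on-c, τ-on-d and τ-off, and unfolding t on symbolic
    -- arguments is very expensive.
    opaque
      τ : ℤ → ℤ
      τ = t n c d

    opaque
      unfolding τ

      τ≡t : ∀ x → τ x ≡ t n c d x
      τ≡t x = refl

      τ-on-c : ∀ x → x ≡[mod n ] c → τ x ≡ x - c + d
      τ-on-c x x≡c with x %ℕ n ℕ.≟ c %ℕ n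
      ... | yes _   = refl
      ... | no x≢c  = ⊥-elim (x≢c x≡c)

      τ-on-d : ∀ x → x ≡[mod n ] d → τ x ≡ x - d + c
      τ-on-d x x≡d with x %ℕ n ℕ.≟ c %ℕ n
      ... | yes x≡c = ⊥-elim (c≢d (trans (sym x≡c) x≡d))
      ... | no _ with x %ℕ n ℕ.≟ d %ℕ n
      ...   | yes _   = refl
      ...   | no x≢d  = ⊥-elim (x≢d x≡d)

      τ-off : ∀ x → ¬ x ≡[mod n ] c → ¬ x ≡[mod n ] d → τ x ≡ x
      τ-off x x≢c x≢d with x %ℕ n ℕ.≟ c %ℕ n
      ... | yes x≡c = ⊥-elim (x≢c x≡c)
      ... | no _ with x %ℕ n ℕ.≟ d %ℕ n
      ...   | yes x≡d = ⊥-elim (x≢d x≡d)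
      ...   | no _    = refl

    τ-c : ∀ k → τ (c + k * N) ≡ d + k * N
    τ-c k = trans (τ-on-c (c + k * N) (shift⇒≡[mod] c k)) (swap c d (k * N))
      where swap : ∀ c d m → c + m - c + d ≡ d + m
            swap = solve-∀

    τ-d : ∀ k → τ (d + k * N) ≡ c + k * N
    τ-d k = trans (τ-on-d (d + k * N) (shift⇒≡[mod] d k)) (swap d c (k * N))
      where swap : ∀ c d m → c + m - c + d ≡ d + m
            swap = solve-∀

    data Orbit (x : ℤ) : Set where
      on-c : ∀ k → x ≡ c + k * N → Orbit x
      on-d : ∀ k → x ≡ d + k * N → Orbit x
      off  : ¬ x ≡[mod n ] c → ¬ x ≡[mod n ] d → Orbit x

    orbit : ∀ x → Orbit x
    orbit x with x %ℕ n ℕ.≟ c %ℕ n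
    ... | yes x≡c = uncurry on-c (≡[mod]⇒shift x c x≡c)
    ... | no x≢c with x %ℕ n ℕ.≟ d %ℕ n
    ...   | yes x≡d = uncurry on-d (≡[mod]⇒shift x d x≡d)
    ...   | no x≢d  = off x≢c x≢d

    τ-orbit-periodic : ∀ {u v} → (∀ k → τ (u + k * N) ≡ v + k * N) →
                       ∀ k → τ (u + k * N + N) ≡ τ (u + k * N) + N
    τ-orbit-periodic {u} {v} τ-u k = begin
      τ (u + k * N + N)     ≡⟨ cong τ (regroup u k N) ⟩
      τ (u + (k + 1ℤ) * N)  ≡⟨ τ-u (k + 1ℤ) ⟩
      v + (k + 1ℤ) * N      ≡⟨ sym (regroup v k N) ⟩
      v + k * N + N         ≡⟨ cong (_+ N) (sym (τ-u k)) ⟩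
      τ (u + k * N) + N     ∎
      where
      open ≡-Reasoning
      regroup : ∀ u k N → u + k * N + N ≡ u + (k + 1ℤ) * N
      regroup = solve-∀

    τ-periodic : Periodic τ
    τ-periodic x with orbit x
    ... | on-c k refl = τ-orbit-periodic {c} {d} τ-c k
    ... | on-d k refl = τ-orbit-periodic {d} {c} τ-d k
    ... | off x≢c x≢d = trans (τ-off (x + N) (x≢c ∘ trans (sym x+N≡x)) (x≢d ∘ trans (sym x+N≡x)))
                              (cong (_+ N) (sym (τ-off x x≢c x≢d)))
      where x+N≡x = +N-≡[mod] x

    τ-shift : ∀ x k → τ (x + k * N) ≡ τ x + k * N
    τ-shift = periodic-shift {τ} τ-periodic

    τ-involutive : ∀ x → τ (τ x) ≡ x
    τ-involutive x with orbit x
    ... | on-c k refl = trans (cong τ (τ-c k)) (τ-d k)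
    ... | on-d k refl = trans (cong τ (τ-d k)) (τ-c k)
    ... | off x≢c x≢d = trans (cong τ τx≡x) τx≡x
      where τx≡x = τ-off x x≢c x≢d

    τ-pair : ℤ × ℤ → ℤ × ℤ
    τ-pair (a , b) with τ a <? τ b
    ... | yes _ = τ a , τ b
    ... | no  _ = a , b

    τ-pair-elim : ∀ (P : ℤ × ℤ → Set) {a b} →
                  (τ a < τ b → P (τ a , τ b)) → (¬ τ a < τ b → P (a , b)) → P (τ-pair (a , b))
    τ-pair-elim P {a} {b} moved kept with τ a <? τ b
    ... | yes τa<τb = moved τa<τb
    ... | no τa≮τb  = kept τa≮τb

    τ-pair-shift : ∀ k p → τ-pair (shift k p) ≡ shift k (τ-pair p)
    τ-pair-shift k (a , b) = τ-pair-elim (λ q → τ-pair (shift k (a , b)) ≡ shift k q) moved kept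
      where
      moved : τ a < τ b → τ-pair (shift k (a , b)) ≡ (τ a + k * N , τ b + k * N)
      moved τa<τb = τ-pair-elim (λ q → q ≡ (τ a + k * N , τ b + k * N))
        (λ _ → cong₂ _,_ (τ-shift a k) (τ-shift b k))
        (λ τa'≮τb' → ⊥-elim (τa'≮τb'
          (subst₂ _<_ (sym (τ-shift a k)) (sym (τ-shift b k)) (+-monoˡ-< (k * N) τa<τb))))
      kept : ¬ τ a < τ b → τ-pair (shift k (a , b)) ≡ shift k (a , b)
      kept τa≮τb = τ-pair-elim (λ q → q ≡ shift k (a , b))
        (λ τa'<τb' → ⊥-elim (τa≮τb (+-cancelʳ-< (k * N) (subst₂ _<_ (τ-shift a k) (τ-shift b k) τa'<τb'))))
        (λ _ → refl)

    τ-pair-involutive : ∀ {a b} → a < b → τ-pair (τ-pair (a , b)) ≡ (a , b)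
    τ-pair-involutive {a} {b} a<b = τ-pair-elim (λ q → τ-pair q ≡ (a , b)) moved kept
      where
      moved : τ a < τ b → τ-pair (τ a , τ b) ≡ (a , b)
      moved _ = τ-pair-elim (λ q → q ≡ (a , b))
        (λ _ → cong₂ _,_ (τ-involutive a) (τ-involutive b))
        (λ ττa≮ττb → ⊥-elim (ττa≮ττb (subst₂ _<_ (sym (τ-involutive a)) (sym (τ-involutive b)) a<b)))
      kept : ¬ τ a < τ b → τ-pair (a , b) ≡ (a , b)
      kept τa≮τb = τ-pair-elim (λ q → q ≡ (a , b)) (λ τa<τb → ⊥-elim (τa≮τb τa<τb)) (λ _ → refl)

    τ-raises-c : ∀ k → c + k * N ≤ τ (c + k * N)
    τ-raises-c k = subst (c + k * N ≤_) (sym (τ-c k)) (<⇒≤ (+-monoˡ-< (k * N) c<d))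

    τ-lowers-d : ∀ k → τ (d + k * N) ≤ d + k * N
    τ-lowers-d k = subst (_≤ d + k * N) (sym (τ-d k)) (<⇒≤ (+-monoˡ-< (k * N) c<d))

    data Reversal (a b : ℤ) : Set where
      c-d   : ∀ k j → a ≡ c + k * N → b ≡ d + j * N → Reversal a b
      c-off : ∀ k → a ≡ c + k * N → τ b ≡ b → Reversal a b
      off-d : ∀ j → τ a ≡ a → b ≡ d + j * N → Reversal a b

    no-reversal : ∀ {a b} → a < b → τ b ≤ τ a → τ a ≤ a → b ≤ τ b → ⊥
    no-reversal a<b τb≤τa τa≤a b≤τb =
      <-irrefl refl (≤-<-trans τb≤τa (≤-<-trans τa≤a (<-≤-trans a<b b≤τb)))

    -- τ translates each class rigidly (the class of c up, that of d down), so it can only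
    -- reverse a < b by moving a up or b down.
    reversal : ∀ {a b} → a < b → ¬ τ a < τ b → Reversal a b
    reversal {a} {b} a<b τa≮τb with orbit a | orbit b
    ... | on-c k refl | on-c j refl =
      ⊥-elim (translates-keep-order {c} {d} {k} {j} a<b (subst₂ _≤_ (τ-c j) (τ-c k) (≮⇒≥ τa≮τb)))
    ... | on-c k refl | on-d j refl = c-d k j refl refl
    ... | on-c k refl | off b≢c b≢d = c-off k refl (τ-off b b≢c b≢d)
    ... | on-d k refl | on-c j refl =
      ⊥-elim (no-reversal a<b (≮⇒≥ τa≮τb) (τ-lowers-d k) (τ-raises-c j))
    ... | on-d k refl | on-d j refl =
      ⊥-elim (translates-keep-order {d} {c} {k} {j} a<b (subst₂ _≤_ (τ-d j) (τ-d k) (≮⇒≥ τa≮τb)))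
    ... | on-d k refl | off b≢c b≢d =
      ⊥-elim (no-reversal a<b (≮⇒≥ τa≮τb) (τ-lowers-d k) (≤-reflexive (sym (τ-off b b≢c b≢d))))
    ... | off a≢c a≢d | on-c j refl =
      ⊥-elim (no-reversal a<b (≮⇒≥ τa≮τb) (≤-reflexive (τ-off a a≢c a≢d)) (τ-raises-c j))
    ... | off a≢c a≢d | on-d j refl = off-d j (τ-off a a≢c a≢d) refl
    ... | off a≢c a≢d | off b≢c b≢d =
      ⊥-elim (no-reversal a<b (≮⇒≥ τa≮τb) (≤-reflexive (τ-off a a≢c a≢d))
                                           (≤-reflexive (sym (τ-off b b≢c b≢d))))

  module Covering (f : ℤ → ℤ) (f-periodic : Periodic f) (f-injective : ∀ {x y} → f x ≡ f y → x ≡ y)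
                  {c d : ℤ} (c<d : c < d) (fd<fc : f d < f c)
                  (empty-between : ∀ e → c < e → e < d → f d < f e → f e < f c → ⊥)
                  (small : d - c < N ⊎ f c - f d < N) where

    f-shift : ∀ x k → f (x + k * N) ≡ f x + k * N
    f-shift = periodic-shift {f} f-periodic

    -- Opaque like τ: only the fact matters, and unfolding its proof makes checking very expensive.
    opaque
      c≢d : ¬ c ≡[mod n ] d
      c≢d c≡d = translate-absurd (≡[mod]⇒shift c d c≡d)
        where
        cancel : ∀ d fd m → d - (d + m) - 1ℤ + (fd + m - fd - 1ℤ) + + 1 ≡ -1ℤ
        cancel = solve-∀
        translate-absurd : (Σ ℤ λ k → c ≡ d + k * N) → ⊥
        translate-absurd (k , c≡d+kN) = refute
          (0≤-+ (0≤-+ (<-gap (subst (_< d) c≡d+kN c<d))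
                      (<-gap (subst (f d <_) (trans (cong f c≡d+kN) (f-shift d k)) fd<fc)))
                (0≤-ℕ 1))
          (cancel d (f d) (k * N))

    open Transposition c d c<d c≢d public

    g : ℤ → ℤ
    g x = f (τ x)

    g-periodic : Periodic g
    g-periodic x = trans (cong f (τ-periodic x)) (f-periodic (τ x))

    below-between : ∀ {e} → c < e → e < d → f e < f c → f e < f d
    below-between {e} c<e e<d fe<fc with <-cmp (f e) (f d)
    ... | tri< fe<fd _ _ = fe<fd
    ... | tri≈ _ fe≡fd _ = ⊥-elim (<-irrefl (f-injective fe≡fd) e<d)
    ... | tri> _ _ fd<fe = ⊥-elim (empty-between e c<e e<d fd<fe fe<fc)

    above-between : ∀ {e} → c < e → e < d → f d < f e → f c < f e
    above-between {e} c<e e<d fd<fe with <-cmp (f c) (f e)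
    ... | tri< fc<fe _ _ = fc<fe
    ... | tri≈ _ fc≡fe _ = ⊥-elim (<-irrefl (f-injective fc≡fe) c<e)
    ... | tri> _ _ fe<fc = ⊥-elim (empty-between e c<e e<d fd<fe fe<fc)

    f-shifted : ∀ k → f (d + k * N) < f (c + k * N)
    f-shifted k = subst₂ _<_ (sym (f-shift d k)) (sym (f-shift c k)) (+-monoˡ-< (k * N) fd<fc)

    f∘τ-c : ∀ k → f (τ (c + k * N)) < f (c + k * N)
    f∘τ-c k = subst (_< f (c + k * N)) (cong f (sym (τ-c k))) (f-shifted k)

    f∘τ-d : ∀ k → f (d + k * N) < f (τ (d + k * N))
    f∘τ-d k = subst (f (d + k * N) <_) (cong f (sym (τ-d k))) (f-shifted k)

    reversal-keeps-f-inverted : ∀ {a b} → Reversal a b → f (τ b) < f (τ a) → f b < f a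
    reversal-keeps-f-inverted (c-d k j refl refl) fτb<fτa = <-trans (f∘τ-d j) (<-trans fτb<fτa (f∘τ-c k))
    reversal-keeps-f-inverted (c-off k refl τb≡b) fτb<fτa =
      subst (_< f (c + k * N)) (cong f τb≡b) (<-trans fτb<fτa (f∘τ-c k))
    reversal-keeps-f-inverted (off-d j τa≡a refl) fτb<fτa =
      subst (f (d + j * N) <_) (cong f τa≡a) (<-trans (f∘τ-d j) fτb<fτa)

    g-inverted⇒f-inverted : ∀ p → Inverted g p → Inverted f (τ-pair p)
    g-inverted⇒f-inverted (a , b) (a<b , gb<ga) = τ-pair-elim (Inverted f)
      (λ τa<τb → τa<τb , gb<ga)
      (λ τa≮τb → a<b , reversal-keeps-f-inverted (reversal a<b τa≮τb) gb<ga)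

    g-inverted⇒τ-pair-off-orbit : ∀ p → Inverted g p → ∀ k → τ-pair p ≢ shift k (c , d)
    g-inverted⇒τ-pair-off-orbit (a , b) (a<b , gb<ga) k = τ-pair-elim (_≢ shift k (c , d))
      (λ _ eq → <-asym (+-monoˡ-< (k * N) c<d) (subst₂ _<_ (a≡ eq) (b≡ eq) a<b))
      (λ _ eq → <-asym (f-shifted k) (subst₂ _<_ (gb≡ eq) (ga≡ eq) gb<ga))
      where
      a≡ : (τ a , τ b) ≡ shift k (c , d) → a ≡ d + k * N
      a≡ eq = trans (sym (τ-involutive a)) (trans (cong (τ ∘ proj₁) eq) (τ-c k))
      b≡ : (τ a , τ b) ≡ shift k (c , d) → b ≡ c + k * N
      b≡ eq = trans (sym (τ-involutive b)) (trans (cong (τ ∘ proj₂) eq) (τ-d k))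
      ga≡ : (a , b) ≡ shift k (c , d) → g a ≡ f (d + k * N)
      ga≡ eq = trans (cong (g ∘ proj₁) eq) (cong f (τ-c k))
      gb≡ : (a , b) ≡ shift k (c , d) → g b ≡ f (c + k * N)
      gb≡ eq = trans (cong (g ∘ proj₂) eq) (cong f (τ-d k))

    -- The one place where the hypothesis d - c < N or f c - f d < N is needed.
    crossed-translates : d - c < N ⊎ f c - f d < N → ∀ {k j} → j ≢ k → c + k * N < d + j * N →
                         c + j * N ≤ d + k * N → f d + j * N < f c + k * N → f c + j * N < f d + k * N
    crossed-translates (inj₁ d-c<N) {k} {j} j≢k ckN<djN cjN≤dkN _ =
      ⊥-elim (j≢k (i-j≡0⇒i≡j j k (multiple-within-period⇒≡0 (j - k)
        (gap⇒< (0≤-+ (0≤-+ (<-gap d-c<N) (<-gap ckN<djN)) (0≤-ℕ 1)) (lower c d k j N))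
        (gap⇒< (0≤-+ (<-gap d-c<N) (≤-gap cjN≤dkN)) (upper c d k j N)))))
      where
      lower : ∀ c d k j N →
              N - (d - c) - 1ℤ + (d + j * N - (c + k * N) - 1ℤ) + + 1 ≡ (j - k) * N - (- N) - 1ℤ
      lower = solve-∀
      upper : ∀ c d k j N → N - (d - c) - 1ℤ + (d + k * N - (c + j * N)) ≡ N - (j - k) * N - 1ℤ
      upper = solve-∀
    crossed-translates (inj₂ fc-fd<N) {k} {j} j≢k _ _ fdjN<fckN =
      [ (λ j-k≡0 → ⊥-elim (j≢k (i-j≡0⇒i≡j j k j-k≡0))) , far ]′ (*N<N⇒≡0⊎≤-N (j - k) [j-k]N<N)
      where
      below : ∀ fc fd k j N →
              N - (fc - fd) - 1ℤ + (fc + k * N - (fd + j * N) - 1ℤ) + + 1 ≡ N - (j - k) * N - 1ℤ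
      below = solve-∀
      [j-k]N<N : (j - k) * N < N
      [j-k]N<N = gap⇒< (0≤-+ (0≤-+ (<-gap fc-fd<N) (<-gap fdjN<fckN)) (0≤-ℕ 1)) (below (f c) (f d) k j N)
      cancel : ∀ fc fd k j N → - N - (j - k) * N + (N - (fc - fd) - 1ℤ) ≡ fd + k * N - (fc + j * N) - 1ℤ
      cancel = solve-∀
      far : (j - k) * N ≤ - N → f c + j * N < f d + k * N
      far [j-k]N≤-N = gap⇒< (0≤-+ (≤-gap [j-k]N≤-N) (<-gap fc-fd<N)) (cancel (f c) (f d) k j N)

    untranslate : ∀ k {y} → c + k * N < y → y < d + k * N → Σ ℤ λ e → c < e × e < d × y ≡ e + k * N
    untranslate k {y} c+kN<y y<d+kN =
      y - k * N ,
      +-cancelʳ-< (k * N) (subst (c + k * N <_) y≡ c+kN<y) ,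
      +-cancelʳ-< (k * N) (subst (_< d + k * N) y≡ y<d+kN) ,
      y≡
      where
      sub-add : ∀ y m → y ≡ y - m + m
      sub-add = solve-∀
      y≡ = sub-add y (k * N)

    fixed-inside-c-translate : ∀ k {y} → c + k * N < y → τ y ≡ y → τ y ≤ τ (c + k * N) →
                               f y < f (c + k * N) → f y < f (d + k * N)
    fixed-inside-c-translate k {y} c+kN<y τy≡y τy≤τ[c+kN] fy<f[c+kN] = below (untranslate k c+kN<y y<d+kN)
      where
      y≢d+kN : y ≢ d + k * N
      y≢d+kN y≡ =
        <-irrefl (trans (sym (τ-d k)) (trans (cong τ (sym y≡)) (trans τy≡y y≡))) (+-monoˡ-< (k * N) c<d)
      y<d+kN = ≤∧≢⇒< (subst₂ _≤_ τy≡y (τ-c k) τy≤τ[c+kN]) y≢d+kN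
      below : (Σ ℤ λ e → c < e × e < d × y ≡ e + k * N) → f y < f (d + k * N)
      below (e , c<e , e<d , y≡e+kN) = subst (_< f (d + k * N)) (sym fy≡) (subst (f e + k * N <_) (sym (f-shift d k))
          (+-monoˡ-< (k * N) (below-between c<e e<d (+-cancelʳ-< (k * N) (subst₂ _<_ fy≡ (f-shift c k) fy<f[c+kN])))))
        where fy≡ = trans (cong f y≡e+kN) (f-shift e k)

    fixed-inside-d-translate : ∀ j {x} → x < d + j * N → τ x ≡ x → τ (d + j * N) ≤ τ x →
                               f (d + j * N) < f x → f (c + j * N) < f x
    fixed-inside-d-translate j {x} x<d+jN τx≡x τ[d+jN]≤τx f[d+jN]<fx = above (untranslate j c+jN<x x<d+jN)
      where
      x≢c+jN : x ≢ c + j * N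
      x≢c+jN x≡ =
        <-irrefl (sym (trans (sym (τ-c j)) (trans (cong τ (sym x≡)) (trans τx≡x x≡)))) (+-monoˡ-< (j * N) c<d)
      c+jN<x = ≤∧≢⇒< (subst₂ _≤_ (τ-d j) τx≡x τ[d+jN]≤τx) (x≢c+jN ∘ sym)
      above : (Σ ℤ λ e → c < e × e < d × x ≡ e + j * N) → f (c + j * N) < f x
      above (e , c<e , e<d , x≡e+jN) = subst (f (c + j * N) <_) (sym fx≡) (subst (_< f e + j * N) (sym (f-shift c j))
          (+-monoˡ-< (j * N) (above-between c<e e<d (+-cancelʳ-< (j * N) (subst₂ _<_ (f-shift d j) fx≡ f[d+jN]<fx)))))
        where fx≡ = trans (cong f x≡e+jN) (f-shift e j)

    reversal-keeps-g-inverted : ∀ {x y} → Reversal x y → x < y → ¬ τ x < τ y → f y < f x →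
                                (∀ k → (x , y) ≢ shift k (c , d)) → f (τ y) < f (τ x)
    reversal-keeps-g-inverted (c-d k j refl refl) x<y τx≮τy fy<fx off-orbit =
      subst₂ _<_ (sym (trans (cong f (τ-d j)) (f-shift c j))) (sym (trans (cong f (τ-c k)) (f-shift d k)))
        (crossed-translates small {k} {j} j≢k x<y (subst₂ _≤_ (τ-d j) (τ-c k) (≮⇒≥ τx≮τy))
          (subst₂ _<_ (f-shift d j) (f-shift c k) fy<fx))
      where j≢k : j ≢ k
            j≢k j≡k = off-orbit k (cong (λ i → c + k * N , d + i * N) j≡k)
    reversal-keeps-g-inverted (c-off k refl τy≡y) x<y τx≮τy fy<fx _ =
      subst₂ _<_ (cong f (sym τy≡y)) (cong f (sym (τ-c k)))
        (fixed-inside-c-translate k x<y τy≡y (≮⇒≥ τx≮τy) fy<fx)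
    reversal-keeps-g-inverted (off-d j τx≡x refl) x<y τx≮τy fy<fx _ =
      subst₂ _<_ (cong f (sym (τ-d j))) (cong f (sym τx≡x))
        (fixed-inside-d-translate j x<y τx≡x (≮⇒≥ τx≮τy) fy<fx)

    f-inverted⇒g-inverted : ∀ p → Inverted f p → (∀ k → p ≢ shift k (c , d)) → Inverted g (τ-pair p)
    f-inverted⇒g-inverted (x , y) (x<y , fy<fx) off-orbit = τ-pair-elim (Inverted g)
      (λ τx<τy → τx<τy , subst₂ _<_ (cong f (sym (τ-involutive y))) (cong f (sym (τ-involutive x))) fy<fx)
      (λ τx≮τy → x<y , reversal-keeps-g-inverted (reversal x<y τx≮τy) x<y τx≮τy fy<fx off-orbit)

    φ : ℤ × ℤ → ℤ × ℤ
    φ = normalise ∘ τ-pair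

    φ-involutive : ∀ p → InWindow p → proj₁ p < proj₂ p → φ (φ p) ≡ p
    φ-involutive p@(a , b) p∈W a<b = begin
      normalise (τ-pair (normalise (τ-pair p)))  ≡⟨ cong (normalise ∘ τ-pair) i-shift ⟩
      normalise (τ-pair (shift i (τ-pair p)))    ≡⟨ cong normalise (τ-pair-shift i (τ-pair p)) ⟩
      normalise (shift i (τ-pair (τ-pair p)))    ≡⟨ normalise-shift i (τ-pair (τ-pair p)) ⟩
      normalise (τ-pair (τ-pair p))              ≡⟨ cong normalise (τ-pair-involutive a<b) ⟩
      normalise p                                ≡⟨ normalise-InWindow-id p p∈W ⟩
      p                                          ∎
      where
      open ≡-Reasoning
      i = proj₁ (normalise-is-shift (τ-pair p))
      i-shift = proj₂ (normalise-is-shift (τ-pair p))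

    q₀ : ℤ × ℤ
    q₀ = normalise (c , d)

    q₀-inversion : Inversion n f q₀
    q₀-inversion = Equivalence.from (Inversion⇔ f q₀)
      (normalise-InWindow (c , d) , Inverted-normalise {f} f-periodic (c , d) (c<d , fd<fc))

    φ-into : ∀ {p} → Inversion n g p → Inversion n f (φ p) × φ p ≢ q₀
    φ-into {p} inv = Equivalence.from (Inversion⇔ f (φ p))
        (normalise-InWindow (τ-pair p) ,
         Inverted-normalise {f} f-periodic (τ-pair p) (g-inverted⇒f-inverted p p-inverted)) ,
      λ φp≡q₀ → let (k , τ-pair-p≡) = normalise-≡⇒shift (τ-pair p) (c , d) φp≡q₀
                in g-inverted⇒τ-pair-off-orbit p p-inverted k τ-pair-p≡
      where p-inverted = proj₂ (Equivalence.to (Inversion⇔ g p) inv)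

    φ-involutiveᵍ : ∀ {p} → Inversion n g p → φ (φ p) ≡ p
    φ-involutiveᵍ {p} inv with Equivalence.to (Inversion⇔ g p) inv
    ... | p∈W , a<b , _ = φ-involutive p p∈W a<b

    φ-involutiveᶠ : ∀ {q} → Inversion n f q → q ≢ q₀ → φ (φ q) ≡ q
    φ-involutiveᶠ {q} inv _ with Equivalence.to (Inversion⇔ f q) inv
    ... | q∈W , a<b , _ = φ-involutive q q∈W a<b

    φ-onto : ∀ {q} → Inversion n f q → q ≢ q₀ → Inversion n g (φ q)
    φ-onto {q} inv q≢q₀ = Equivalence.from (Inversion⇔ g (φ q))
      (normalise-InWindow (τ-pair q) ,
       Inverted-normalise {g} g-periodic (τ-pair q) (f-inverted⇒g-inverted q q-inverted off-orbit))
      where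
      q∈W = proj₁ (Equivalence.to (Inversion⇔ f q) inv)
      q-inverted = proj₂ (Equivalence.to (Inversion⇔ f q) inv)
      off-orbit : ∀ k → q ≢ shift k (c , d)
      off-orbit k q≡ =
        q≢q₀ (trans (sym (normalise-InWindow-id q q∈W)) (trans (cong normalise q≡) (normalise-shift k (c , d))))

    length-drop : LengthDrop n f g
    length-drop =
      let (m , g-length) = periodic-HasLength {g} g-periodic
      in m , Counts-suc (≡-dec _≟_ _≟_) φ φ q₀ q₀-inversion φ-into φ-involutiveᵍ φ-onto φ-involutiveᶠ g-length ,
         g-length

  Inversion-cong : ∀ {F G} → (∀ x → F x ≡ G x) → ∀ p → Inversion n F p ⇔ Inversion n G p
  Inversion-cong F≗G (a , b) = mk⇔ (transport F≗G) (transport (λ x → sym (F≗G x)))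
    where
    transport : ∀ {F G} → (∀ x → F x ≡ G x) → Inversion n F (a , b) → Inversion n G (a , b)
    transport F≗G (1≤a , a≤N , a<b , Fb<Fa) = 1≤a , a≤N , a<b , subst₂ _<_ (F≗G b) (F≗G a) Fb<Fa

  covering-transposition : (w : AffPerm n) → ∀ {c d} → c < d → fun w d < fun w c →
    (∀ e → c < e → e < d → fun w d < fun w e → fun w e < fun w c → ⊥) →
    d - c < N ⊎ fun w c - fun w d < N →
    ¬ c ≡[mod n ] d × LengthDrop n (fun w) (w ·t[ c , d ])
  covering-transposition w c<d fd<fc empty-between small =
    c≢d , m , f-length , Counts-cong (Inversion-cong (cong (fun w) ∘ τ≡t)) g-length
    where
    open Covering (fun w) (periodic w) (proj₁ (bij w)) c<d fd<fc empty-between small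
    m = proj₁ length-drop
    f-length = proj₁ (proj₂ length-drop)
    g-length = proj₂ (proj₂ length-drop)

  module _ (w : AffPerm n) where

    Small : ℤ → ℤ → Set
    Small i j = j - i < N ⊎ fun w i - fun w j < N

    Intermediate : ℤ → ℤ → ℤ → Set
    Intermediate i j e = i < e × e < j × fun w j < fun w e × fun w e < fun w i

    Small-left : ∀ {i j e} → Intermediate i j e → Small i j → Small i e
    Small-left {i} (_ , e<j , fj<fe , _) =
      Sum.map (<-trans (+-monoˡ-< (- i) e<j)) (<-trans (+-monoʳ-< (fun w i) (neg-mono-< fj<fe)))

    Small-right : ∀ {i j e} → Intermediate i j e → Small i j → Small e j
    Small-right {j = j} (i<e , _ , _ , fe<fi) =
      Sum.map (<-trans (+-monoʳ-< j (neg-mono-< i<e))) (<-trans (+-monoˡ-< (- fun w j) fe<fi))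

    DescChain-++ : ∀ {i e j} → DescChain w i e → DescChain w e j → DescChain w i j
    DescChain-++ done                        rest = rest
    DescChain-++ (step i<i' i≢i' drop chain) rest = step i<i' i≢i' drop (DescChain-++ chain rest)

    ∣∣-mono-< : ∀ {x y} → 0≤ x → x < y → ∣ x ∣ ℕ.< ∣ y ∣
    ∣∣-mono-< (+≤+ _) (+<+ m<n) = m<n

    distance-pos : ∀ {i j} → i < j → 0 ℕ.< ∣ j - i ∣
    distance-pos {i} {j} i<j = ∣∣-mono-< ≤-refl (subst (_< j - i) (+-inverseʳ i) (+-monoˡ-< (- i) i<j))

    distance-left : ∀ {i j e} → i < e → e < j → ∣ e - i ∣ ℕ.< ∣ j - i ∣
    distance-left {i} i<e e<j = ∣∣-mono-< (≤-gap (<⇒≤ i<e)) (+-monoˡ-< (- i) e<j)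

    distance-right : ∀ {i j e} → i < e → e < j → ∣ j - e ∣ ℕ.< ∣ j - i ∣
    distance-right {j = j} i<e e<j = ∣∣-mono-< (≤-gap (<⇒≤ e<j)) (+-monoʳ-< j (neg-mono-< i<e))

    Intermediate? : ∀ i j e → Dec (Intermediate i j e)
    Intermediate? i j e = (i <? e) ×-dec ((e <? j) ×-dec ((fun w j <? fun w e) ×-dec (fun w e <? fun w i)))

    descent-chain-within : ∀ m i j → ∣ j - i ∣ ℕ.≤ m → i < j → fun w j < fun w i → Small i j →
                           DescChain w i j
    descent-chain-within zero i j bound i<j _ _ = ⊥-elim (ℕₚ.<⇒≱ (distance-pos i<j) bound)
    descent-chain-within (suc m) i j bound i<j fj<fi small
      with anyUpTo? (λ l → Intermediate? i j (i + + l)) ∣ j - i ∣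
    ... | yes (_ , _ , mid@(i<e , e<j , fj<fe , fe<fi)) =
      DescChain-++ (descent-chain-within m i _ (shrink (distance-left i<e e<j)) i<e fe<fi (Small-left mid small))
                   (descent-chain-within m _ j (shrink (distance-right i<e e<j)) e<j fj<fe (Small-right mid small))
      where
      shrink : ∀ {l} → l ℕ.< ∣ j - i ∣ → l ℕ.≤ m
      shrink l<d = ℕ.s≤s⁻¹ (ℕₚ.<-≤-trans l<d bound)
    ... | no none = step i<j i≢j drop done
      where
      add-sub : ∀ i e → i + (e - i) ≡ e
      add-sub = solve-∀
      at-offset : ∀ {e} → i < e → i + + ∣ e - i ∣ ≡ e
      at-offset {e} i<e = trans (cong (λ x → i + x) (0≤i⇒+∣i∣≡i (≤-gap (<⇒≤ i<e)))) (add-sub i e)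
      empty-between : ∀ e → i < e → e < j → fun w j < fun w e → fun w e < fun w i → ⊥
      empty-between e i<e e<j fj<fe fe<fi =
        none (∣ e - i ∣ , distance-left i<e e<j ,
              subst (Intermediate i j) (sym (at-offset i<e)) (i<e , e<j , fj<fe , fe<fi))
      i≢j = proj₁ (covering-transposition w i<j fj<fi empty-between small)
      drop = proj₂ (covering-transposition w i<j fj<fi empty-between small)

    descent-chain : ∀ i j → i < j → fun w j < fun w i → Small i j → DescChain w i j
    descent-chain i j = descent-chain-within ∣ j - i ∣ i j ℕₚ.≤-refl

lemma4p3 : (n : ℕ) .{{_ : NonZero n}} (w : AffPerm n) (i j : ℤ) →
    i < j → fun w j < fun w i →
    ((j - i) < + n ⊎ (fun w i - fun w j) < + n) →
    DescChain w i j
lemma4p3 n w = descent-chain n w
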